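{- If $A\subseteq\omega$ is dense immune, then $\pi(A)$ is dense immune for every computable permutation $\pi:\omega\to\omega$.
   Context: The principal function of an infinite set $A$ is $p_A(n)=\mu x\,[\,|A\cap[0,x)|\ge n\,]$. An infinite set $A$ is dense immune if $p_A$ dominates every computable function: for every computable $f$, $p_A(n)\ge f(n)$ for all sufficiently large $n$. -}

module Defs where

open import Data.Nat using (ℕ; zero; suc; _+_; _≤_; _<_; _≥_)
open import Data.Fin using (Fin)
open import Data.Vec using (Vec; []; _∷_; lookup)
open import Data.Bool using (Bool; true; false)
open import Data.Product using (Σ; _×_; ∃; ∃-syntax)
open import Relation.Binary.PropositionalEquality using (_≡_)

data PR : ℕ → Set where
  zer  : ∀ {n} → PR n
  succ : PR 1
  proj : ∀ {n} → Fin n → PR n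
  comp : ∀ {m n} → PR m → Vec (PR n) m → PR n
  prec : ∀ {n} → PR n → PR (suc (suc n)) → PR (suc n)
  mu   : ∀ {n} → PR (suc n) → PR n

-- Big-step evaluation: Eval e xs y  means  e(xs) is defined and equals y.
mutual
  data Eval : ∀ {n} → PR n → Vec ℕ n → ℕ → Set where
    ev-zer  : ∀ {n} {xs : Vec ℕ n} → Eval zer xs 0
    ev-succ : ∀ {x} → Eval succ (x ∷ []) (suc x)
    ev-proj : ∀ {n} {i : Fin n} {xs : Vec ℕ n} → Eval (proj i) xs (lookup xs i)
    ev-comp : ∀ {m n} {f : PR m} {gs : Vec (PR n) m} {xs : Vec ℕ n}
                {ys : Vec ℕ m} {y : ℕ} →
              EvalVec gs xs ys → Eval f ys y → Eval (comp f gs) xs y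
    ev-prec0 : ∀ {n} {g : PR n} {h : PR (suc (suc n))} {xs : Vec ℕ n} {y : ℕ} →
               Eval g xs y → Eval (prec g h) (0 ∷ xs) y
    ev-precS : ∀ {n} {g : PR n} {h : PR (suc (suc n))} {xs : Vec ℕ n} {x r y : ℕ} →
               Eval (prec g h) (x ∷ xs) r → Eval h (x ∷ r ∷ xs) y →
               Eval (prec g h) (suc x ∷ xs) y
    ev-mu   : ∀ {n} {f : PR (suc n)} {xs : Vec ℕ n} {y : ℕ} →
              Eval f (y ∷ xs) 0 →
              (∀ z → z < y → Σ ℕ (λ k → Eval f (z ∷ xs) (suc k))) →
              Eval (mu f) xs y

  data EvalVec : ∀ {m n} → Vec (PR n) m → Vec ℕ n → Vec ℕ m → Set where
    evv-[] : ∀ {n} {xs : Vec ℕ n} → EvalVec [] xs []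
    evv-∷  : ∀ {m n} {g : PR n} {gs : Vec (PR n) m} {xs : Vec ℕ n} {y : ℕ} {ys : Vec ℕ m} →
             Eval g xs y → EvalVec gs xs ys → EvalVec (g ∷ gs) xs (y ∷ ys)

Computable : (ℕ → ℕ) → Set
Computable f = Σ (PR 1) (λ e → ∀ n → Eval e (n ∷ []) (f n))

-- Sets of naturals as characteristic functions (arbitrary, not necessarily computable).

Set⊆ω : Set
Set⊆ω = ℕ → Bool

count : Set⊆ω → ℕ → ℕ
count A zero = zero
count A (suc x) with A x
... | true  = suc (count A x)
... | false = count A x

Infinite : Set⊆ω → Set
Infinite A = ∀ n → Σ ℕ (λ m → n ≤ m × A m ≡ true)

-- p_A(n) = x  :  x is the least x with |A ∩ [0,x)| ≥ n
IsPrincipal : Set⊆ω → ℕ → ℕ → Set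
IsPrincipal A n x = n ≤ count A x × (∀ y → y < x → count A y < n)

DenseImmune : Set⊆ω → Set
DenseImmune A = Infinite A ×
  (∀ f → Computable f →
     Σ ℕ (λ N → ∀ n → N ≤ n → ∀ x → IsPrincipal A n x → f n ≤ x))

record ComputablePerm : Set where
  field
    π        : ℕ → ℕ
    π⁻¹      : ℕ → ℕ
    computable : Computable π
    left     : ∀ x → π⁻¹ (π x) ≡ x
    right    : ∀ y → π (π⁻¹ y) ≡ y

-- π(A) = { π x | x ∈ A }, whose characteristic function is  y ↦ A (π⁻¹ y).
image : ComputablePerm → Set⊆ω → Set⊆ω
image p A y = A (ComputablePerm.π⁻¹ p y)

module Submission where

-- Let π be a computable permutation and put  S(m) = Σ_{y<m} (π⁻¹(y) + 1).
-- S is computable (π⁻¹ is found by unbounded search for a zero of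
-- |π w - y|, and prefix sums are primitive recursive), strictly increasing,
-- and π⁻¹(y) < S(m) whenever y < m.  Hence π⁻¹ maps π(A) ∩ [0,x) injectively
-- into A ∩ [0,S(x)), so  |π(A) ∩ [0,x)| ≤ |A ∩ [0,S(x))|  and therefore
-- p_A(n) ≤ S(p_{π(A)}(n)).  If f is computable, so is S ∘ f, and dense
-- immunity of A gives S(f(n)) ≤ p_A(n) ≤ S(p_{π(A)}(n)) for large n; since
-- S is strictly increasing, f(n) ≤ p_{π(A)}(n).  Infinitude of π(A) follows
-- from the same bound: an element m ≥ S(n) of A has π(m) ≥ n.

open import Defs
open import Data.Nat using (ℕ; zero; suc; _+_; _∸_; _≤_; _<_; z≤n; s≤s; pred; _≤?_; _≟_; ∣_-_∣)
open import Data.Nat.Properties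
open import Data.Fin using () renaming (zero to fz; suc to fs)
open import Data.Vec using (Vec; []; _∷_)
open import Data.Bool using (Bool; true; false)
open import Data.Product using (Σ; _×_; _,_)
open import Data.Sum using (inj₁; inj₂)
open import Data.Empty using (⊥-elim)
open import Function using (_∘_)
open import Relation.Nullary using (yes; no; ¬_)
open import Relation.Binary.PropositionalEquality

ev-comp₁ : ∀ {n} {f : PR 1} {g : PR n} {xs : Vec ℕ n} {a c : ℕ} →
           Eval g xs a → Eval f (a ∷ []) c → Eval (comp f (g ∷ [])) xs c
ev-comp₁ eg ef = ev-comp (evv-∷ eg evv-[]) ef

ev-comp₂ : ∀ {n} {f : PR 2} {g h : PR n} {xs : Vec ℕ n} {a b c : ℕ} →
           Eval g xs a → Eval h xs b → Eval f (a ∷ b ∷ []) c →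
           Eval (comp f (g ∷ h ∷ [])) xs c
ev-comp₂ eg eh ef = ev-comp (evv-∷ eg (evv-∷ eh evv-[])) ef

addP : PR 2
addP = prec (proj fz) (comp succ (proj (fs fz) ∷ []))

eval-add : ∀ a b → Eval addP (a ∷ b ∷ []) (a + b)
eval-add zero    b = ev-prec0 ev-proj
eval-add (suc a) b = ev-precS (eval-add a b) (ev-comp₁ ev-proj ev-succ)

predP : PR 1
predP = prec zer (proj fz)

eval-pred : ∀ a → Eval predP (a ∷ []) (pred a)
eval-pred zero    = ev-prec0 ev-zer
eval-pred (suc a) = ev-precS (eval-pred a) ev-proj

monusP : PR 2
monusP = prec (proj fz) (comp predP (proj (fs fz) ∷ []))

eval-monus : ∀ b a → Eval monusP (b ∷ a ∷ []) (a ∸ b)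
eval-monus zero    a = ev-prec0 ev-proj
eval-monus (suc b) a = subst (Eval monusP (suc b ∷ a ∷ [])) (pred[m∸n]≡m∸[1+n] a b)
  (ev-precS (eval-monus b a) (ev-comp₁ ev-proj (eval-pred (a ∸ b))))

suc-computable : Computable suc
suc-computable = succ , λ n → ev-succ

∘-computable : ∀ {f g : ℕ → ℕ} → Computable f → Computable g → Computable (f ∘ g)
∘-computable {f} {g} (ef , eval-f) (eg , eval-g) =
  comp ef (eg ∷ []) , λ n → ev-comp₁ (eval-g n) (eval-f (g n))

prefixSum : (ℕ → ℕ) → ℕ → ℕ
prefixSum g zero    = zero
prefixSum g (suc m) = prefixSum g m + g m

prefixSum-computable : ∀ {g : ℕ → ℕ} → Computable g → Computable (prefixSum g)
prefixSum-computable {g} (eg , eval-g) = sumP , eval-sum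
  where
  sumP : PR 1
  sumP = prec zer (comp addP (proj (fs fz) ∷ comp eg (proj fz ∷ []) ∷ []))

  eval-sum : ∀ m → Eval sumP (m ∷ []) (prefixSum g m)
  eval-sum zero    = ev-prec0 ev-zer
  eval-sum (suc m) = ev-precS (eval-sum m)
    (ev-comp₂ ev-proj (ev-comp₁ ev-proj (eval-g m)) (eval-add (prefixSum g m) (g m)))

∸+∸≡∣-∣ : ∀ a b → (a ∸ b) + (b ∸ a) ≡ ∣ a - b ∣
∸+∸≡∣-∣ zero    zero    = refl
∸+∸≡∣-∣ zero    (suc b) = refl
∸+∸≡∣-∣ (suc a) zero    = +-identityʳ (suc a)
∸+∸≡∣-∣ (suc a) (suc b) = ∸+∸≡∣-∣ a b

-- A program whose value is nonzero has a value of the form  suc k,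
-- as the side condition of μ-search demands.
positive-value : ∀ {n} {e : PR n} {xs : Vec ℕ n} {v : ℕ} →
                 Eval e xs v → ¬ v ≡ 0 → Σ ℕ (λ k → Eval e xs (suc k))
positive-value {v = zero}  ev v≢0 with () ← v≢0 refl
positive-value {v = suc k} ev v≢0 = k , ev

-- The inverse of a computable bijection is computable: g(y) is the least w
-- with |f(w) - y| = 0.
inverse-computable : ∀ {f g : ℕ → ℕ} → Computable f →
                     (∀ x → g (f x) ≡ x) → (∀ y → f (g y) ≡ y) → Computable g
inverse-computable {f} {g} (ef , eval-f) g∘f f∘g =
  mu distP , λ y → ev-mu (root y) (below-root y)
  where
  -- The programs below take the argument vector (w, y);
  -- distP computes  (f(w) ∸ y) + (y ∸ f(w)) = |f(w) - y|.
  valueP argP : PR 2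
  valueP = comp ef (proj fz ∷ [])
  argP   = proj (fs fz)

  distP : PR 2
  distP = comp addP ( comp monusP (argP ∷ valueP ∷ [])
                   ∷ comp monusP (valueP ∷ argP ∷ []) ∷ [])

  eval-dist : ∀ w y → Eval distP (w ∷ y ∷ []) ∣ f w - y ∣
  eval-dist w y = subst (Eval distP (w ∷ y ∷ [])) (∸+∸≡∣-∣ (f w) y)
    (ev-comp₂ (ev-comp₂ ev-proj fw (eval-monus y (f w)))
              (ev-comp₂ fw ev-proj (eval-monus (f w) y))
              (eval-add (f w ∸ y) (y ∸ f w)))
    where
    fw : Eval valueP (w ∷ y ∷ []) (f w)
    fw = ev-comp₁ ev-proj (eval-f w)

  root : ∀ y → Eval distP (g y ∷ y ∷ []) 0
  root y = subst (Eval distP (g y ∷ y ∷ [])) (m≡n⇒∣m-n∣≡0 (f∘g y)) (eval-dist (g y) y)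

  below-root : ∀ y z → z < g y → Σ ℕ (λ k → Eval distP (z ∷ y ∷ []) (suc k))
  below-root y z z<gy = positive-value (eval-dist z y)
    (λ dist≡0 → <⇒≢ z<gy (trans (sym (g∘f z)) (cong g (∣m-n∣≡0⇒m≡n dist≡0))))

step-mono : (f : ℕ → ℕ) → (∀ n → f n ≤ f (suc n)) → ∀ {m n} → m ≤ n → f m ≤ f n
step-mono f step {n = zero}  z≤n = ≤-refl
step-mono f step {n = suc n} m≤1+n with m≤n⇒m<n∨m≡n m≤1+n
... | inj₂ refl  = ≤-refl
... | inj₁ m<1+n = ≤-trans (step-mono f step (≤-pred m<1+n)) (step n)

step-strict : (f : ℕ → ℕ) → (∀ n → f n < f (suc n)) → ∀ {m n} → m < n → f m < f n
step-strict f step {m} m<n = <-≤-trans (step m) (step-mono f (<⇒≤ ∘ step) m<n)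

step-reflects : (f : ℕ → ℕ) → (∀ n → f n < f (suc n)) → ∀ {m n} → f m ≤ f n → m ≤ n
step-reflects f step fm≤fn = ≮⇒≥ (λ n<m → <⇒≱ (step-strict f step n<m) fm≤fn)

prefixSum-step : ∀ (g : ℕ → ℕ) n → prefixSum (suc ∘ g) n < prefixSum (suc ∘ g) (suc n)
prefixSum-step g n = m<m+n (prefixSum (suc ∘ g) n) (s≤s z≤n)

prefixSum-bound : ∀ (g : ℕ → ℕ) {i m} → i < m → g i < prefixSum (suc ∘ g) m
prefixSum-bound g {i} i<m = ≤-trans (m≤n+m (suc (g i)) (prefixSum (suc ∘ g) i))
  (step-mono (prefixSum (suc ∘ g)) (<⇒≤ ∘ prefixSum-step g) i<m)

bit : Bool → ℕ
bit true  = 1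
bit false = 0

count-suc : ∀ D b → count D (suc b) ≡ bit (D b) + count D b
count-suc D b with D b
... | true  = refl
... | false = refl

count-step : ∀ D b → count D b ≤ count D (suc b)
count-step D b = subst (count D b ≤_) (sym (count-suc D b)) (m≤n+m (count D b) (bit (D b)))

count-ext : ∀ D D' B → (∀ w → w < B → D w ≡ D' w) → count D B ≡ count D' B
count-ext D D' zero    agree = refl
count-ext D D' (suc B) agree
  rewrite count-suc D B | count-suc D' B | agree B ≤-refl
        | count-ext D D' B (λ w w<B → agree w (m≤n⇒m≤1+n w<B)) = refl

delete : Set⊆ω → ℕ → Set⊆ω
delete D z w with w ≟ z
... | yes _ = false
... | no _  = D w

delete-same : ∀ D z → delete D z z ≡ false
delete-same D z with z ≟ z
... | yes _   = refl
... | no z≢z = ⊥-elim (z≢z refl)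

delete-other : ∀ D z w → ¬ w ≡ z → delete D z w ≡ D w
delete-other D z w w≢z with w ≟ z
... | yes w≡z = ⊥-elim (w≢z w≡z)
... | no _    = refl

count-delete : ∀ D B z → z < B → D z ≡ true → count D B ≡ suc (count (delete D z) B)
count-delete D (suc B) z z<1+B Dz with m<1+n⇒m<n∨m≡n z<1+B
... | inj₂ refl
  rewrite count-suc D z | count-suc (delete D z) z | delete-same D z | Dz =
    cong suc (count-ext D (delete D z) z (λ w w<z → sym (delete-other D z w (<⇒≢ w<z))))
... | inj₁ z<B
  rewrite count-suc D B | count-suc (delete D z) B
        | delete-other D z B (λ B≡z → <⇒≢ z<B (sym B≡z))
        | count-delete D B z z<B Dz = +-suc (bit (D B)) (count (delete D z) B)

count-injection : ∀ (C D : Set⊆ω) (g : ℕ → ℕ) x B →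
  (∀ y z → g y ≡ g z → y ≡ z) →
  (∀ y → y < x → g y < B) →
  (∀ y → y < x → C y ≡ true → D (g y) ≡ true) →
  count C x ≤ count D B
count-injection C D g zero    B inj into member = z≤n
count-injection C D g (suc x) B inj into member rewrite count-suc C x with C x in Cx
... | false = count-injection C D g x B inj (λ y y<x → into y (m≤n⇒m≤1+n y<x))
                                            (λ y y<x → member y (m≤n⇒m≤1+n y<x))
... | true rewrite count-delete D B (g x) (into x ≤-refl) (member x ≤-refl Cx) =
      s≤s (count-injection C (delete D (g x)) g x B inj
             (λ y y<x → into y (m≤n⇒m≤1+n y<x))
             (λ y y<x Cy → trans (delete-other D (g x) (g y) (λ gy≡gx → <⇒≢ y<x (inj y x gy≡gx)))
                                 (member y (m≤n⇒m≤1+n y<x) Cy)))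

principal-below : ∀ A n B → n ≤ count A B → Σ ℕ (λ z → z ≤ B × IsPrincipal A n z)
principal-below A n zero    n≤count = zero , z≤n , n≤count , (λ y ())
principal-below A n (suc B) n≤count with n ≤? count A B
... | yes n≤countB = let (z , z≤B , principal) = principal-below A n B n≤countB
                     in z , m≤n⇒m≤1+n z≤B , principal
... | no n≰countB  = suc B , ≤-refl , n≤count ,
      λ y y<1+B → ≤-<-trans (step-mono (count A) (count-step A) (≤-pred y<1+B)) (≰⇒> n≰countB)

module _ (p : ComputablePerm) where
  open ComputablePerm p

  S : ℕ → ℕ
  S = prefixSum (suc ∘ π⁻¹)

  S-computable : Computable S
  S-computable = prefixSum-computable
    (∘-computable suc-computable (inverse-computable computable left right))

  S-reflects : ∀ {m n} → S m ≤ S n → m ≤ n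
  S-reflects = step-reflects S (prefixSum-step π⁻¹)

  count-image : ∀ A x → count (image p A) x ≤ count A (S x)
  count-image A x = count-injection (image p A) A π⁻¹ x (S x)
    (λ y z eq → trans (sym (right y)) (trans (cong π eq) (right z)))
    (λ y → prefixSum-bound π⁻¹)
    (λ y _ member → member)

  principal-image : ∀ A {n x} → IsPrincipal (image p A) n x →
                    Σ ℕ (λ z → z ≤ S x × IsPrincipal A n z)
  principal-image A {n} {x} (n≤count , _) =
    principal-below A n (S x) (≤-trans n≤count (count-image A x))

  -- An element m ≥ S(n) of A yields the element π(m) ≥ n of π(A).
  image-infinite : ∀ A → Infinite A → Infinite (image p A)
  image-infinite A infinite n with infinite (S n)
  ... | m , Sn≤m , Am = π m , n≤πm , trans (cong A (left m)) Am
    where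
    n≤πm : n ≤ π m
    n≤πm = ≮⇒≥ (λ πm<n → <⇒≱ (subst (_< S n) (left m) (prefixSum-bound π⁻¹ πm<n)) Sn≤m)

mainTheorem16 : (A : Set⊆ω) → DenseImmune A → (p : ComputablePerm) → DenseImmune (image p A)
mainTheorem16 A (infinite , dominates) p = image-infinite p A infinite , image-dominates
  where
  image-dominates : ∀ f → Computable f →
    Σ ℕ (λ N → ∀ n → N ≤ n → ∀ x → IsPrincipal (image p A) n x → f n ≤ x)
  image-dominates f f-computable
    with dominates (S p ∘ f) (∘-computable (S-computable p) f-computable)
  ... | N , S∘f≤p_A = N , λ n N≤n x x-principal →
    let (z , z≤Sx , z-principal) = principal-image p A x-principal
    in S-reflects p (≤-trans (S∘f≤p_A n N≤n z z-principal) z≤Sx)
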